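{- Let $t$ be a non-negative integer and $n$ a positive integer. Let $M(z)=M_\alpha(z)$ be the formal power series (with coefficients polynomials in $\alpha$) satisfying $M(z)=1+2zM(z)+\alpha z^2M(z)^2$. Then $$\frac {\partial} {\partial\alpha}\left(\langle z^n\rangle\frac {\alpha \left(zM(z)\right)^{t+2}} {(1+zM(z))^2}\right)\Bigg\vert_{\alpha=1}=\binom {2n-5}{n-t-2}+\binom {2n-5}{n-t-3}+(n-3)\binom {2n-5}{n-t-4}-(n+1)\binom {2n-5}{n-t-5}.$$
   Context: $M(z)$ is the unique formal power series in $z$ with coefficients in $\mathbb Z[\alpha]$ satisfying the stated equation (the specialisation $x=y=1$ of $M=1+(x+y)zM+\alpha z^2M^2$). $\langle z^n\rangle F(z)$ denotes the coefficient of $z^n$ in $F(z)$. Binomial convention: $\binom{a}{k}=a(a-1)\cdots(a-k+1)/k!$ for integers $k\ge0$ (any integer $a$) and $\binom ak=0$ for $k<0$. -}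

module Defs where

open import Data.Nat as ℕ using (ℕ; zero; suc)
open import Data.Nat.Properties using (_!≢0)
open import Data.Integer as ℤ using (ℤ; +_; _+_; _*_; _-_; -_; 0ℤ; 1ℤ; _<_)
open import Data.Integer.DivMod using (_/ℕ_)
open import Data.List using (List; []; _∷_; map; foldr; upTo)
open import Relation.Nullary using (yes; no)
open import Relation.Binary.PropositionalEquality using (_≡_)

-- Polynomials in α with integer coefficients: ℤ[α].
-- A list [c₀, c₁, …] represents c₀ + c₁ α + c₂ α² + …
-- Equality of polynomials is coefficientwise (trailing zeros ignored).

Poly : Set
Poly = List ℤ

coeffP : Poly → ℕ → ℤ
coeffP []      _       = 0ℤ
coeffP (c ∷ p) zero    = c
coeffP (c ∷ p) (suc k) = coeffP p k

_≈P_ : Poly → Poly → Set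
p ≈P q = ∀ k → coeffP p k ≡ coeffP q k

infixl 6 _+P_
infixl 7 _*P_

_+P_ : Poly → Poly → Poly
[]      +P q       = q
(a ∷ p) +P []      = a ∷ p
(a ∷ p) +P (b ∷ q) = (a + b) ∷ (p +P q)

_*P_ : Poly → Poly → Poly
[]      *P q = []
(a ∷ p) *P q = map (a *_) q +P (0ℤ ∷ (p *P q))

constP : ℤ → Poly
constP c = c ∷ []

αP : Poly
αP = 0ℤ ∷ 1ℤ ∷ []

-- formal derivative d/dα :  d(a + α p) = p + α p'
∂α : Poly → Poly
∂α []      = []
∂α (a ∷ p) = p +P (0ℤ ∷ ∂α p)

evalP : Poly → ℤ → ℤ
evalP p x = foldr (λ c acc → c + x * acc) 0ℤ p

-- Formal power series in z with coefficients in ℤ[α]:  ⟨zⁿ⟩ F = F n.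

Series : Set
Series = ℕ → Poly

infix 4 _≈S_ _≈P_
_≈S_ : Series → Series → Set
F ≈S G = ∀ n → F n ≈P G n

sumP : List Poly → Poly
sumP = foldr _+P_ []

infixl 6 _+S_
infixl 7 _*S_
infixr 8 _^S_

_+S_ : Series → Series → Series
(F +S G) n = F n +P G n

_*S_ : Series → Series → Series
(F *S G) n = sumP (map (λ i → F i *P G (n ℕ.∸ i)) (upTo (suc n)))

constS : Poly → Series
constS p zero    = p
constS p (suc n) = []

zS : Series → Series
zS F zero    = []
zS F (suc n) = F n

_^S_ : Series → ℕ → Series
F ^S zero  = constS (constP 1ℤ)
F ^S suc k = F *S (F ^S k)

-- Binomial coefficients with integer top:
--   binom a k = a(a-1)…(a-k+1)/k!  for k ≥ 0,   and 0 for k < 0.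

falling : ℤ → ℕ → ℤ
falling a zero    = 1ℤ
falling a (suc k) = falling a k * (a - + k)

binomℕ : ℤ → ℕ → ℤ
binomℕ a k = (falling a k /ℕ (k ℕ.!)) {{k !≢0}}

binom : ℤ → ℤ → ℤ
binom a (+ k)      = binomℕ a k
binom a ℤ.-[1+ k ] = 0ℤ

-- Evaluating a polynomial in α at α = 1 + ε, where ε² = 0, gives p(1) + p′(1) ε. So the
-- coefficient in question is the ε-part of ⟨zⁿ⟩ Q computed over the dual numbers ℤ[ε], where
-- u = z M satisfies u = z (1 + 2u + (1 + ε) u²). There z (1 + u)² = u − ε z u², whence
-- Q = (1 + ε) u^(t+2) / (1 + u)² = z u^(t+1) (1 + ε + ε z u). The recurrence
-- u^(k+1) = z (u^k + 2 u^(k+1) + (1 + ε) u^(k+2)) and Pascal's rule give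
--   ⟨z^(m+1)⟩ u^k = C(2m+1, j) − C(2m+1, j−1) + k C(2m, j−2) ε,   j = m + 1 − k,
-- and Pascal's rule with the absorption identity (x + 1) C(r, x + 1) = (r − x) C(r, x)
-- turns the ε-part of ⟨zⁿ⟩ Q into the stated combination of binomials C(2n − 5, ·).

module Submission where

import Algebra.Solver.Ring.NaturalCoefficients.Default as NaturalCoefficientsSolver
open import Algebra.Bundles using (CommutativeRing; CommutativeSemiring; RawRing)
open import Algebra.Core using (Op₁; Op₂)
open import Algebra.Structures using (IsCommutativeRing)
import Data.Integer as ℤ
import Data.Integer.Properties as ℤ
open import Data.Integer.Tactic.RingSolver using (solve-∀)
open import Data.List using ([]; _∷_; foldr; map; applyUpTo; upTo)
open import Data.List.Properties using (map-applyUpTo)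
open import Data.Nat using (ℕ; zero; suc; _∸_; _≤_; _<_; z≤n; s≤s)
import Data.Nat as ℕ
open import Data.Nat.Combinatorics using (_C_; nCk+nC[k+1]≡[n+1]C[k+1]; nCk≡nC[n∸k])
open import Data.Nat.Combinatorics.Base using (_P′_; _C′_)
open import Data.Nat.Combinatorics.Specification using (nC′k≡n!/k![n-k]!; nCk≡n!/k![n-k]!; k>n⇒nCk≡0)
open import Data.Nat.DivMod using (0/n≡0)
open import Data.Nat.Induction using (<-rec)
import Data.Nat.Properties as ℕ
open import Data.Nat.Properties using (≤-refl; m≤n⇒m≤1+n; _!≢0)
open import Data.Product using (_×_; _,_; proj₁; proj₂)
open import Data.Sum using (inj₁; inj₂)
open import Function using (_∘_)
open import Level using (0ℓ)
open import Relation.Binary.PropositionalEquality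
  using (_≡_; refl; sym; trans; cong; cong₂; isEquivalence; module ≡-Reasoning)
open import Relation.Nullary using (yes; no)

open import Defs

IsCommutativeRing≡ : RawRing 0ℓ 0ℓ → Set
IsCommutativeRing≡ R = IsCommutativeRing _≡_ _+_ _*_ -_ 0# 1#
  where open RawRing R

module DualNumbers (R : RawRing 0ℓ 0ℓ) (isCR : IsCommutativeRing≡ R) where

  open RawRing R using (Carrier; _+_; _*_; -_; 0#; 1#)
  private
    R-commutativeSemiring : CommutativeSemiring 0ℓ 0ℓ
    R-commutativeSemiring = record { isCommutativeSemiring = IsCommutativeRing.isCommutativeSemiring isCR }
  open NaturalCoefficientsSolver R-commutativeSemiring

  Dual : Set
  Dual = Carrier × Carrier

  infixl 6 _+ᵈ_
  infixl 7 _*ᵈ_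

  _+ᵈ_ : Op₂ Dual
  (a , a′) +ᵈ (b , b′) = a + b , a′ + b′

  _*ᵈ_ : Op₂ Dual
  (a , a′) *ᵈ (b , b′) = a * b , a * b′ + a′ * b

  -ᵈ_ : Op₁ Dual
  -ᵈ (a , a′) = - a , - a′

  ι : Carrier → Dual
  ι a = a , 0#

  ι-* : ∀ a b → ι (a * b) ≡ ι a *ᵈ ι b
  ι-* a b = cong (a * b ,_) (solve 2 (λ a b → con 0 := a :* con 0 :+ con 0 :* b) refl a b)

  0ᵈ 1ᵈ ε : Dual
  0ᵈ = ι 0#
  1ᵈ = ι 1#
  ε  = 0# , 1#

  isCommutativeRing : IsCommutativeRing _≡_ _+ᵈ_ _*ᵈ_ -ᵈ_ 0ᵈ 1ᵈ
  isCommutativeRing = record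
    { isRing = record
      { +-isAbelianGroup = record
        { isGroup = record
          { isMonoid = record
            { isSemigroup = record
              { isMagma = record { isEquivalence = isEquivalence ; ∙-cong = cong₂ _+ᵈ_ }
              ; assoc = λ { (a , a′) (b , b′) (c , c′) → cong₂ _,_ (+-assoc a b c) (+-assoc a′ b′ c′) } }
            ; identity = (λ { (a , a′) → cong₂ _,_ (+-identityˡ a) (+-identityˡ a′) })
                       , (λ { (a , a′) → cong₂ _,_ (+-identityʳ a) (+-identityʳ a′) }) }
          ; inverse = (λ { (a , a′) → cong₂ _,_ (-‿inverseˡ a) (-‿inverseˡ a′) })
                    , (λ { (a , a′) → cong₂ _,_ (-‿inverseʳ a) (-‿inverseʳ a′) })
          ; ⁻¹-cong = cong -ᵈ_ }
        ; comm = λ { (a , a′) (b , b′) → cong₂ _,_ (+-comm a b) (+-comm a′ b′) } }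
      ; *-cong = cong₂ _*ᵈ_
      ; *-assoc = λ { (a , a′) (b , b′) (c , c′) → cong₂ _,_ (*-assoc a b c)
          (solve 6 (λ a a′ b b′ c c′ → a :* b :* c′ :+ (a :* b′ :+ a′ :* b) :* c
                     := a :* (b :* c′ :+ b′ :* c) :+ a′ :* (b :* c)) refl a a′ b b′ c c′) }
      ; *-identity = (λ { (a , a′) → cong₂ _,_ (*-identityˡ a)
                        (solve 2 (λ a a′ → con 1 :* a′ :+ con 0 :* a := a′) refl a a′) })
                   , (λ { (a , a′) → cong₂ _,_ (*-identityʳ a)
                        (solve 2 (λ a a′ → a :* con 0 :+ a′ :* con 1 := a′) refl a a′) })
      ; distrib = (λ { (a , a′) (b , b′) (c , c′) → cong₂ _,_ (distribˡ a b c)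
                     (solve 6 (λ a a′ b b′ c c′ → a :* (b′ :+ c′) :+ a′ :* (b :+ c)
                        := (a :* b′ :+ a′ :* b) :+ (a :* c′ :+ a′ :* c)) refl a a′ b b′ c c′) })
                , (λ { (a , a′) (b , b′) (c , c′) → cong₂ _,_ (distribʳ a b c)
                     (solve 6 (λ a a′ b b′ c c′ → (b :+ c) :* a′ :+ (b′ :+ c′) :* a
                        := (b :* a′ :+ b′ :* a) :+ (c :* a′ :+ c′ :* a)) refl a a′ b b′ c c′) })
      }
    ; *-comm = λ { (a , a′) (b , b′) → cong₂ _,_ (*-comm a b)
        (solve 4 (λ a a′ b b′ → a :* b′ :+ a′ :* b := b :* a′ :+ b′ :* a) refl a a′ b b′) }
    }
    where
    open IsCommutativeRing isCR
      using (+-assoc; +-identityˡ; +-identityʳ; -‿inverseˡ; -‿inverseʳ; +-comm;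
             *-assoc; *-identityˡ; *-identityʳ; distribˡ; distribʳ; *-comm)

  commutativeRing : CommutativeRing 0ℓ 0ℓ
  commutativeRing = record { isCommutativeRing = isCommutativeRing }

module PowerSeries (R : RawRing 0ℓ 0ℓ) (isCR : IsCommutativeRing≡ R) where

  open RawRing R using (Carrier; _+_; _*_; -_; 0#; 1#)
  private
    R-commutativeRing : CommutativeRing 0ℓ 0ℓ
    R-commutativeRing = record { isCommutativeRing = isCR }
  open CommutativeRing R-commutativeRing
    using (+-assoc; +-comm; +-identityˡ; +-identityʳ; -‿inverseˡ; -‿inverseʳ; +-congˡ;
           *-identityˡ; *-assoc; distribʳ; *-comm; zeroˡ; zeroʳ; commutativeSemiring; +-group)
  open NaturalCoefficientsSolver commutativeSemiring

  PowerSeries : Set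
  PowerSeries = ℕ → Carrier

  infix  4 _≐_
  infixl 6 _⊕_
  infixl 7 _⊛_
  infix  8 ⊝_
  infixr 9 _^_

  _≐_ : PowerSeries → PowerSeries → Set
  F ≐ G = ∀ n → F n ≡ G n

  _⊕_ : PowerSeries → PowerSeries → PowerSeries
  (F ⊕ G) n = F n + G n

  ⊝_ : PowerSeries → PowerSeries
  (⊝ F) n = - F n

  const : Carrier → PowerSeries
  const c zero    = c
  const c (suc n) = 0#

  𝟘 𝟙 : PowerSeries
  𝟘 n = 0#
  𝟙 = const 1#

  z·_ : PowerSeries → PowerSeries
  (z· F) zero    = 0#
  (z· F) (suc n) = F n

  tail : PowerSeries → PowerSeries
  tail F n = F (suc n)

  _⊛_ : PowerSeries → PowerSeries → PowerSeries
  (F ⊛ G) zero    = F 0 * G 0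
  (F ⊛ G) (suc n) = F 0 * G (suc n) + (tail F ⊛ G) n

  _^_ : PowerSeries → ℕ → PowerSeries
  F ^ zero  = 𝟙
  F ^ suc k = F ⊛ F ^ k

  ⊛-cong : ∀ {F F′ G G′} → F ≐ F′ → G ≐ G′ → F ⊛ G ≐ F′ ⊛ G′
  ⊛-cong F≐F′ G≐G′ zero    = cong₂ _*_ (F≐F′ 0) (G≐G′ 0)
  ⊛-cong F≐F′ G≐G′ (suc n) =
    cong₂ _+_ (cong₂ _*_ (F≐F′ 0) (G≐G′ (suc n))) (⊛-cong (λ k → F≐F′ (suc k)) G≐G′ n)

  ^-cong : ∀ {F G} → F ≐ G → ∀ k → F ^ k ≐ G ^ k
  ^-cong F≐G zero    = λ _ → refl
  ^-cong F≐G (suc k) = ⊛-cong F≐G (^-cong F≐G k)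

  z·-cong : ∀ {F G} → F ≐ G → z· F ≐ z· G
  z·-cong F≐G zero    = refl
  z·-cong F≐G (suc n) = F≐G n

  ⊛-zeroˡ : ∀ G → 𝟘 ⊛ G ≐ 𝟘
  ⊛-zeroˡ G zero    = zeroˡ (G 0)
  ⊛-zeroˡ G (suc n) = trans (cong₂ _+_ (zeroˡ (G (suc n))) (⊛-zeroˡ G n)) (+-identityˡ 0#)

  const-⊛ : ∀ c G → const c ⊛ G ≐ λ n → c * G n
  const-⊛ c G zero    = refl
  const-⊛ c G (suc n) = trans (+-congˡ (⊛-zeroˡ G n)) (+-identityʳ _)

  const-⊕ : ∀ a b → const a ⊕ const b ≐ const (a + b)
  const-⊕ a b zero    = refl
  const-⊕ a b (suc n) = +-identityˡ 0#

  ⊛-identityˡ : ∀ G → 𝟙 ⊛ G ≐ G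
  ⊛-identityˡ G n = trans (const-⊛ 1# G n) (*-identityˡ (G n))

  z·-⊛ : ∀ F G → (z· F) ⊛ G ≐ z· (F ⊛ G)
  z·-⊛ F G zero    = zeroˡ (G 0)
  z·-⊛ F G (suc n) = trans (cong (_+ (F ⊛ G) n) (zeroˡ (G (suc n)))) (+-identityˡ _)

  ⊛-distribʳ : ∀ F G H → (F ⊕ G) ⊛ H ≐ F ⊛ H ⊕ G ⊛ H
  ⊛-distribʳ F G H zero    = distribʳ (H 0) (F 0) (G 0)
  ⊛-distribʳ F G H (suc n) rewrite ⊛-distribʳ (tail F) (tail G) H n =
    solve 5 (λ f g h x y → (f :+ g) :* h :+ (x :+ y) := (f :* h :+ x) :+ (g :* h :+ y))
      refl (F 0) (G 0) (H (suc n)) ((tail F ⊛ H) n) ((tail G ⊛ H) n)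

  ⊛-comm : ∀ F G → F ⊛ G ≐ G ⊛ F
  ⊛-comm F G zero          = *-comm (F 0) (G 0)
  ⊛-comm F G (suc zero)    =
    solve 4 (λ f₀ f₁ g₀ g₁ → f₀ :* g₁ :+ f₁ :* g₀ := g₀ :* f₁ :+ g₁ :* f₀) refl (F 0) (F 1) (G 0) (G 1)
  ⊛-comm F G (suc (suc n)) = begin
      F 0 * G₂ + (tail F ⊛ G) (suc n)             ≡⟨ +-congˡ (⊛-comm (tail F) G (suc n)) ⟩
      F 0 * G₂ + (G 0 * F₂ + (tail G ⊛ tail F) n) ≡⟨ cong (λ x → F 0 * G₂ + (G 0 * F₂ + x))
                                                           (⊛-comm (tail G) (tail F) n) ⟩
      F 0 * G₂ + (G 0 * F₂ + (tail F ⊛ tail G) n) ≡⟨ solve 5 (λ f₀ g₀ f₂ g₂ x →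
                                                        f₀ :* g₂ :+ (g₀ :* f₂ :+ x) := g₀ :* f₂ :+ (f₀ :* g₂ :+ x))
                                                        refl (F 0) (G 0) F₂ G₂ ((tail F ⊛ tail G) n) ⟩
      G 0 * F₂ + (F 0 * G₂ + (tail F ⊛ tail G) n) ≡⟨ +-congˡ (⊛-comm (tail G) F (suc n)) ⟨
      G 0 * F₂ + (tail G ⊛ F) (suc n)             ∎
    where
    open ≡-Reasoning
    F₂ = F (suc (suc n))
    G₂ = G (suc (suc n))

  ⊛-scaleˡ : ∀ c F G → (λ n → c * F n) ⊛ G ≐ λ n → c * (F ⊛ G) n
  ⊛-scaleˡ c F G zero    = *-assoc c (F 0) (G 0)
  ⊛-scaleˡ c F G (suc n) rewrite ⊛-scaleˡ c (tail F) G n =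
    solve 4 (λ c f g x → c :* f :* g :+ c :* x := c :* (f :* g :+ x)) refl c (F 0) (G (suc n)) ((tail F ⊛ G) n)

  ⊛-assoc : ∀ F G H → (F ⊛ G) ⊛ H ≐ F ⊛ (G ⊛ H)
  ⊛-assoc F G H n = begin
      ((F ⊛ G) ⊛ H) n
        ≡⟨ ⊛-cong split (λ _ → refl) n ⟩
      (((λ k → F 0 * G k) ⊕ z· (tail F ⊛ G)) ⊛ H) n
        ≡⟨ ⊛-distribʳ _ _ H n ⟩
      ((λ k → F 0 * G k) ⊛ H) n + ((z· (tail F ⊛ G)) ⊛ H) n
        ≡⟨ cong₂ _+_ (⊛-scaleˡ (F 0) G H n) (z·-⊛ (tail F ⊛ G) H n) ⟩
      F 0 * (G ⊛ H) n + (z· ((tail F ⊛ G) ⊛ H)) n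
        ≡⟨ shifted n ⟩
      (F ⊛ (G ⊛ H)) n ∎
    where
    open ≡-Reasoning
    split : F ⊛ G ≐ (λ k → F 0 * G k) ⊕ z· (tail F ⊛ G)
    split zero    = sym (+-identityʳ _)
    split (suc n) = refl
    shifted : ∀ n → F 0 * (G ⊛ H) n + (z· ((tail F ⊛ G) ⊛ H)) n ≡ (F ⊛ (G ⊛ H)) n
    shifted zero    = +-identityʳ _
    shifted (suc m) = +-congˡ (⊛-assoc (tail F) G H m)

  isCommutativeRing : IsCommutativeRing _≐_ _⊕_ _⊛_ ⊝_ 𝟘 𝟙
  isCommutativeRing = record
    { isRing = record
      { +-isAbelianGroup = record
        { isGroup = record
          { isMonoid = record
            { isSemigroup = record
              { isMagma = record
                { isEquivalence = record
                  { refl = λ _ → refl ; sym = λ p n → sym (p n) ; trans = λ p q n → trans (p n) (q n) }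
                ; ∙-cong = λ p q n → cong₂ _+_ (p n) (q n) }
              ; assoc = λ F G H n → +-assoc (F n) (G n) (H n) }
            ; identity = (λ F n → +-identityˡ (F n)) , (λ F n → +-identityʳ (F n)) }
          ; inverse = (λ F n → -‿inverseˡ (F n)) , (λ F n → -‿inverseʳ (F n))
          ; ⁻¹-cong = λ p n → cong -_ (p n) }
        ; comm = λ F G n → +-comm (F n) (G n) }
      ; *-cong = ⊛-cong
      ; *-assoc = ⊛-assoc
      ; *-identity = ⊛-identityˡ , λ F n → trans (⊛-comm F 𝟙 n) (⊛-identityˡ F n)
      ; distrib = (λ F G H n → trans (⊛-comm F (G ⊕ H) n)
                      (trans (⊛-distribʳ G H F n) (cong₂ _+_ (⊛-comm G F n) (⊛-comm H F n))))
                , λ H F G → ⊛-distribʳ F G H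
      }
    ; *-comm = ⊛-comm
    }

  commutativeRing : CommutativeRing 0ℓ 0ℓ
  commutativeRing = record { isCommutativeRing = isCommutativeRing }

  ⊛-vanishes : ∀ F H n → (∀ {k} → k ≤ n → H k ≡ 0#) → (F ⊛ H) n ≡ 0#
  ⊛-vanishes F H zero    H≡0 = trans (cong (F 0 *_) (H≡0 z≤n)) (zeroʳ (F 0))
  ⊛-vanishes F H (suc n) H≡0 =
    trans (cong₂ _+_ (trans (cong (F 0 *_) (H≡0 ≤-refl)) (zeroʳ (F 0)))
                     (⊛-vanishes (tail F) H n (λ k≤n → H≡0 (m≤n⇒m≤1+n k≤n))))
          (+-identityˡ 0#)

  ⊛≐𝟘⇒≐𝟘 : ∀ {W H} → W 0 ≡ 1# → W ⊛ H ≐ 𝟘 → H ≐ 𝟘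
  ⊛≐𝟘⇒≐𝟘 {W} {H} W₀≡1 WH≐0 = <-rec _ vanish
    where
    open ≡-Reasoning
    leading : ∀ n → H n ≡ W 0 * H n
    leading n = trans (sym (*-identityˡ (H n))) (cong (_* H n) (sym W₀≡1))
    vanish : ∀ n → (∀ {k} → k < n → H k ≡ 0#) → H n ≡ 0#
    vanish zero    _  = trans (leading 0) (WH≐0 0)
    vanish (suc n) ih = begin
      H (suc n)                                ≡⟨ leading (suc n) ⟩
      W 0 * H (suc n)                          ≡⟨ +-identityʳ _ ⟨
      W 0 * H (suc n) + 0#                     ≡⟨ +-congˡ (⊛-vanishes (tail W) H n (λ k≤n → ih (s≤s k≤n))) ⟨
      W 0 * H (suc n) + (tail W ⊛ H) n         ≡⟨ WH≐0 (suc n) ⟩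
      0#                                       ∎

  ⊛-cancelʳ : ∀ {W} → W 0 ≡ 1# → ∀ F G → F ⊛ W ≐ G ⊛ W → F ≐ G
  ⊛-cancelʳ {W} W₀≡1 F G FW≐GW n =
    x∙y⁻¹≈ε⇒x≈y (F n) (G n) (⊛≐𝟘⇒≐𝟘 W₀≡1 W[F-G]≐0 n)
    where
    open import Algebra.Properties.Group +-group using (x∙y⁻¹≈ε⇒x≈y)
    open CommutativeRing commutativeRing using (ring; setoid) renaming (-‿inverseʳ to ⊝-inverseʳ; +-congʳ to ⊕-congʳ)
    open import Algebra.Properties.Ring ring using (x[y-z]≈xy-xz)
    open import Relation.Binary.Reasoning.Setoid setoid
    W[F-G]≐0 : W ⊛ (F ⊕ ⊝ G) ≐ 𝟘
    W[F-G]≐0 = begin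
      W ⊛ (F ⊕ ⊝ G)         ≈⟨ x[y-z]≈xy-xz W F G ⟩
      W ⊛ F ⊕ ⊝ (W ⊛ G)     ≈⟨ ⊕-congʳ (⊛-comm W F) ⟩
      F ⊛ W ⊕ ⊝ (W ⊛ G)     ≈⟨ ⊕-congʳ FW≐GW ⟩
      G ⊛ W ⊕ ⊝ (W ⊛ G)     ≈⟨ ⊕-congʳ (⊛-comm G W) ⟩
      W ⊛ G ⊕ ⊝ (W ⊛ G)     ≈⟨ ⊝-inverseʳ (W ⊛ G) ⟩
      𝟘                     ∎

  z : PowerSeries
  z = z· 𝟙

  z·-⊛-z· : ∀ F G → z· F ⊛ z· G ≐ z· (z· (F ⊛ G))
  z·-⊛-z· F G n = trans (z·-⊛ F (z· G) n) (z·-cong (λ k → trans (⊛-comm F (z· G) k)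
                    (trans (z·-⊛ G F k) (z·-cong (⊛-comm G F) k))) n)

  z·-as-⊛ : ∀ F → z· F ≐ z ⊛ F
  z·-as-⊛ F zero    = sym (z·-⊛ 𝟙 F zero)
  z·-as-⊛ F (suc n) = sym (trans (z·-⊛ 𝟙 F (suc n)) (⊛-identityˡ F n))

  ⊛-as-sum : ∀ F G n → (F ⊛ G) n ≡ foldr _+_ 0# (applyUpTo (λ i → F i * G (n ∸ i)) (suc n))
  ⊛-as-sum F G zero    = sym (+-identityʳ _)
  ⊛-as-sum F G (suc n) = +-congˡ (⊛-as-sum (tail F) G n)


open import Data.Integer using (ℤ; 0ℤ; 1ℤ; +_; -[1+_]; _+_; _-_; -_; _*_; +-*-rawRing)

open DualNumbers +-*-rawRing ℤ.+-*-isCommutativeRing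
  renaming (Dual to ℤ[ε]; isCommutativeRing to ℤ[ε]-isCommutativeRing; commutativeRing to ℤ[ε]-commutativeRing)

module ℤ[ε]-Solver = NaturalCoefficientsSolver (CommutativeRing.commutativeSemiring ℤ[ε]-commutativeRing)

open CommutativeRing ℤ[ε]-commutativeRing using ()
  renaming (+-identityˡ to +ᵈ-identityˡ; +-identityʳ to +ᵈ-identityʳ; zeroˡ to *ᵈ-zeroˡ; zeroʳ to *ᵈ-zeroʳ)

jet : ℤ → Poly → ℤ[ε]
jet x p = evalP p x , evalP (∂α p) x

evalP-+P : ∀ p q x → evalP (p +P q) x ≡ evalP p x + evalP q x
evalP-+P []      q       x = sym (ℤ.+-identityˡ _)
evalP-+P (a ∷ p) []      x = sym (ℤ.+-identityʳ _)
evalP-+P (a ∷ p) (b ∷ q) x =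
  trans (cong (λ e → a + b + x * e) (evalP-+P p q x)) (interchange a b x (evalP p x) (evalP q x))
  where
  interchange : ∀ a b x u v → a + b + x * (u + v) ≡ (a + x * u) + (b + x * v)
  interchange = solve-∀

jet-∷ : ∀ x a p → jet x (a ∷ p) ≡ ι a +ᵈ (x , 1ℤ) *ᵈ jet x p
jet-∷ x a p = cong (a + x * evalP p x ,_)
  (trans (evalP-+P p (0ℤ ∷ ∂α p) x) (rearrange x (evalP p x) (evalP (∂α p) x)))
  where
  rearrange : ∀ x e e′ → e + (0ℤ + x * e′) ≡ 0ℤ + (x * e′ + 1ℤ * e)
  rearrange = solve-∀

jet-+P : ∀ x p q → jet x (p +P q) ≡ jet x p +ᵈ jet x q
jet-+P x []      q       = sym (+ᵈ-identityˡ (jet x q))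
jet-+P x (a ∷ p) []      = sym (+ᵈ-identityʳ (jet x (a ∷ p)))
jet-+P x (a ∷ p) (b ∷ q) = begin
  jet x (a + b ∷ p +P q)
    ≡⟨ jet-∷ x (a + b) (p +P q) ⟩
  ι (a + b) +ᵈ (x , 1ℤ) *ᵈ jet x (p +P q)
    ≡⟨ cong (λ j → ι (a + b) +ᵈ (x , 1ℤ) *ᵈ j) (jet-+P x p q) ⟩
  ι a +ᵈ ι b +ᵈ (x , 1ℤ) *ᵈ (jet x p +ᵈ jet x q)
    ≡⟨ solve 5 (λ a b X P Q → a :+ b :+ X :* (P :+ Q) := (a :+ X :* P) :+ (b :+ X :* Q))
         refl (ι a) (ι b) (x , 1ℤ) (jet x p) (jet x q) ⟩
  (ι a +ᵈ (x , 1ℤ) *ᵈ jet x p) +ᵈ (ι b +ᵈ (x , 1ℤ) *ᵈ jet x q)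
    ≡⟨ cong₂ _+ᵈ_ (jet-∷ x a p) (jet-∷ x b q) ⟨
  jet x (a ∷ p) +ᵈ jet x (b ∷ q) ∎
  where
  open ≡-Reasoning
  open ℤ[ε]-Solver

jet-scale : ∀ x a q → jet x (map (a *_) q) ≡ ι a *ᵈ jet x q
jet-scale x a []      = sym (*ᵈ-zeroʳ (ι a))
jet-scale x a (c ∷ q) = begin
  jet x (a * c ∷ map (a *_) q)                  ≡⟨ jet-∷ x (a * c) (map (a *_) q) ⟩
  ι (a * c) +ᵈ (x , 1ℤ) *ᵈ jet x (map (a *_) q) ≡⟨ cong₂ (λ d j → d +ᵈ (x , 1ℤ) *ᵈ j) (ι-* a c) (jet-scale x a q) ⟩
  ι a *ᵈ ι c +ᵈ (x , 1ℤ) *ᵈ (ι a *ᵈ jet x q)    ≡⟨ solve 4 (λ A C X Q → A :* C :+ X :* (A :* Q) := A :* (C :+ X :* Q))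
                                                           refl (ι a) (ι c) (x , 1ℤ) (jet x q) ⟩
  ι a *ᵈ (ι c +ᵈ (x , 1ℤ) *ᵈ jet x q)           ≡⟨ cong (ι a *ᵈ_) (jet-∷ x c q) ⟨
  ι a *ᵈ jet x (c ∷ q)                          ∎
  where
  open ≡-Reasoning
  open ℤ[ε]-Solver

jet-*P : ∀ x p q → jet x (p *P q) ≡ jet x p *ᵈ jet x q
jet-*P x []      q = sym (*ᵈ-zeroˡ (jet x q))
jet-*P x (a ∷ p) q = begin
  jet x (map (a *_) q +P (0ℤ ∷ p *P q))
    ≡⟨ jet-+P x (map (a *_) q) (0ℤ ∷ p *P q) ⟩
  jet x (map (a *_) q) +ᵈ jet x (0ℤ ∷ p *P q)
    ≡⟨ cong₂ _+ᵈ_ (jet-scale x a q) (jet-∷ x 0ℤ (p *P q)) ⟩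
  ι a *ᵈ jet x q +ᵈ (ι 0ℤ +ᵈ (x , 1ℤ) *ᵈ jet x (p *P q))
    ≡⟨ cong (λ j → ι a *ᵈ jet x q +ᵈ (ι 0ℤ +ᵈ (x , 1ℤ) *ᵈ j)) (jet-*P x p q) ⟩
  ι a *ᵈ jet x q +ᵈ (ι 0ℤ +ᵈ (x , 1ℤ) *ᵈ (jet x p *ᵈ jet x q))
    ≡⟨ solve 4 (λ A X P Q → A :* Q :+ (con 0 :+ X :* (P :* Q)) := (A :+ X :* P) :* Q)
         refl (ι a) (x , 1ℤ) (jet x p) (jet x q) ⟩
  (ι a +ᵈ (x , 1ℤ) *ᵈ jet x p) *ᵈ jet x q
    ≡⟨ cong (_*ᵈ jet x q) (jet-∷ x a p) ⟨
  jet x (a ∷ p) *ᵈ jet x q ∎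
  where
  open ≡-Reasoning
  open ℤ[ε]-Solver

jet-null : ∀ x q → [] ≈P q → jet x [] ≡ jet x q
jet-null x []      _    = refl
jet-null x (b ∷ q) []≈q = begin
  jet x []                     ≡⟨ solve 1 (λ X → con 0 := con 0 :+ X :* con 0) refl (x , 1ℤ) ⟩
  ι 0ℤ +ᵈ (x , 1ℤ) *ᵈ jet x [] ≡⟨ cong₂ (λ c j → ι c +ᵈ (x , 1ℤ) *ᵈ j) ([]≈q 0) (jet-null x q ([]≈q ∘ suc)) ⟩
  ι b +ᵈ (x , 1ℤ) *ᵈ jet x q   ≡⟨ jet-∷ x b q ⟨
  jet x (b ∷ q)                ∎
  where
  open ≡-Reasoning
  open ℤ[ε]-Solver

jet-cong : ∀ x p q → p ≈P q → jet x p ≡ jet x q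
jet-cong x []      q       p≈q = jet-null x q p≈q
jet-cong x (a ∷ p) []      p≈q = sym (jet-null x (a ∷ p) (λ k → sym (p≈q k)))
jet-cong x (a ∷ p) (b ∷ q) p≈q = begin
  jet x (a ∷ p)              ≡⟨ jet-∷ x a p ⟩
  ι a +ᵈ (x , 1ℤ) *ᵈ jet x p ≡⟨ cong₂ (λ c j → ι c +ᵈ (x , 1ℤ) *ᵈ j) (p≈q 0) (jet-cong x p q (p≈q ∘ suc)) ⟩
  ι b +ᵈ (x , 1ℤ) *ᵈ jet x q ≡⟨ jet-∷ x b q ⟨
  jet x (b ∷ q)              ∎
  where open ≡-Reasoning

jet-sumP : ∀ x (f : ℕ → Poly) g → (∀ i → jet x (f i) ≡ g i) → ∀ is →
           jet x (sumP (map f is)) ≡ foldr _+ᵈ_ 0ᵈ (map g is)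
jet-sumP x f g f≡g []       = refl
jet-sumP x f g f≡g (i ∷ is) =
  trans (jet-+P x (f i) (sumP (map f is))) (cong₂ _+ᵈ_ (f≡g i) (jet-sumP x f g f≡g is))

open PowerSeries (CommutativeRing.rawRing ℤ[ε]-commutativeRing) ℤ[ε]-isCommutativeRing
  renaming (commutativeRing to ℤ[ε]⟦z⟧-commutativeRing)

module ℤ[ε]⟦z⟧ = CommutativeRing ℤ[ε]⟦z⟧-commutativeRing
module ℤ[ε]⟦z⟧-Solver = NaturalCoefficientsSolver ℤ[ε]⟦z⟧.commutativeSemiring

jetS : Series → PowerSeries
jetS F n = jet 1ℤ (F n)

jetS-cong : ∀ F G → F ≈S G → jetS F ≐ jetS G
jetS-cong F G F≈G n = jet-cong 1ℤ (F n) (G n) (F≈G n)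

jetS-+S : ∀ F G → jetS (F +S G) ≐ jetS F ⊕ jetS G
jetS-+S F G n = jet-+P 1ℤ (F n) (G n)

jetS-*S : ∀ F G → jetS (F *S G) ≐ jetS F ⊛ jetS G
jetS-*S F G n = begin
  jet 1ℤ (sumP (map term (upTo (suc n))))
    ≡⟨ jet-sumP 1ℤ term jet-term (λ i → jet-*P 1ℤ (F i) (G (n ∸ i))) (upTo (suc n)) ⟩
  foldr _+ᵈ_ 0ᵈ (map jet-term (upTo (suc n)))
    ≡⟨ cong (foldr _+ᵈ_ 0ᵈ) (map-applyUpTo (λ i → i) jet-term (suc n)) ⟩
  foldr _+ᵈ_ 0ᵈ (applyUpTo jet-term (suc n))
    ≡⟨ ⊛-as-sum (jetS F) (jetS G) n ⟨
  (jetS F ⊛ jetS G) n ∎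
  where
  open ≡-Reasoning
  term : ℕ → Poly
  term i = F i *P G (n ∸ i)
  jet-term : ℕ → ℤ[ε]
  jet-term i = jetS F i *ᵈ jetS G (n ∸ i)

jetS-zS : ∀ F → jetS (zS F) ≐ z· jetS F
jetS-zS F zero    = refl
jetS-zS F (suc n) = refl

jetS-constS : ∀ p → jetS (constS p) ≐ const (jet 1ℤ p)
jetS-constS p zero    = refl
jetS-constS p (suc n) = refl

jetS-α : jetS (constS αP) ≐ 𝟙 ⊕ const ε
jetS-α n = trans (jetS-constS αP n) (sym (const-⊕ 1ᵈ ε n))

jetS-^S : ∀ F k → jetS (F ^S k) ≐ jetS F ^ k
jetS-^S F zero    = jetS-constS (constP 1ℤ)
jetS-^S F (suc k) n = trans (jetS-*S F (F ^S k) n) (⊛-cong (λ _ → refl) (jetS-^S F k) n)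

ε-part : ∀ a b → proj₂ (a +ᵈ ε *ᵈ b) ≡ proj₂ a + proj₁ b
ε-part (a , a′) (b , b′) = collect a′ b b′
  where
  collect : ∀ a′ b b′ → a′ + (0ℤ * b′ + 1ℤ * b) ≡ a′ + b
  collect = solve-∀

recurrence-components : ∀ a b c → a +ᵈ (1ᵈ +ᵈ 1ᵈ) *ᵈ b +ᵈ (1ᵈ +ᵈ ε) *ᵈ c
                  ≡ (proj₁ a + + 2 * proj₁ b + proj₁ c , proj₂ a + + 2 * proj₂ b + proj₂ c + proj₁ c)
recurrence-components (a , a′) (b , b′) (c , c′) = cong₂ _,_ (value a b c) (derivative a′ b b′ c c′)
  where
  value : ∀ a b c → a + + 2 * b + 1ℤ * c ≡ a + + 2 * b + c
  value = solve-∀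
  derivative : ∀ a′ b b′ c c′ → a′ + (+ 2 * b′ + 0ℤ * b) + (1ℤ * c′ + 1ℤ * c) ≡ a′ + + 2 * b′ + c′ + c
  derivative = solve-∀

choose : ℕ → ℤ → ℤ
choose r (+ k)    = + (r C k)
choose r -[1+ k ] = 0ℤ

choose-pascal : ∀ r j → choose (suc r) j ≡ choose r j + choose r (j - 1ℤ)
choose-pascal r (+ zero)    = refl
choose-pascal r (+ suc k)   =
  cong +_ (trans (sym (nCk+nC[k+1]≡[n+1]C[k+1] r k)) (ℕ.+-comm (r C k) (r C suc k)))
choose-pascal r -[1+ k ]    = refl

x+1-1≡x : ∀ x → x + 1ℤ - 1ℤ ≡ x
x+1-1≡x = solve-∀

x-1+1≡x : ∀ x → x - 1ℤ + 1ℤ ≡ x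
x-1+1≡x = solve-∀

[1+a]-[1+b]≡a-b : ∀ a b → (1ℤ + a) - (1ℤ + b) ≡ a - b
[1+a]-[1+b]≡a-b = solve-∀

a-[1+b]≡a-b-1 : ∀ a b → a - (1ℤ + b) ≡ a - b - 1ℤ
a-[1+b]≡a-b-1 = solve-∀

a-[2+b]≡a-b-1-1 : ∀ a b → a - (1ℤ + (1ℤ + b)) ≡ a - b - 1ℤ - 1ℤ
a-[2+b]≡a-b-1-1 = solve-∀

choose-absorption : ∀ r x → (x + 1ℤ) * choose r (x + 1ℤ) ≡ (+ r - x) * choose r x
choose-absorption zero    (+ zero)     = refl
choose-absorption zero    (+ suc k)    = trans (ℤ.*-zeroʳ (+ suc k + 1ℤ)) (sym (ℤ.*-zeroʳ (+ 0 - + suc k)))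
choose-absorption zero    -[1+ zero ]  = refl
choose-absorption zero    -[1+ suc k ] =
  trans (ℤ.*-zeroʳ (-[1+ suc k ] + 1ℤ)) (sym (ℤ.*-zeroʳ (+ 0 - -[1+ suc k ])))
choose-absorption (suc r) x = begin
  (x + 1ℤ) * choose (suc r) (x + 1ℤ)
    ≡⟨ cong ((x + 1ℤ) *_) (trans (choose-pascal r (x + 1ℤ))
                                 (cong (λ y → choose r (x + 1ℤ) + choose r y) (x+1-1≡x x))) ⟩
  (x + 1ℤ) * (choose r (x + 1ℤ) + choose r x)
    ≡⟨ ℤ.*-distribˡ-+ (x + 1ℤ) (choose r (x + 1ℤ)) (choose r x) ⟩
  (x + 1ℤ) * choose r (x + 1ℤ) + (x + 1ℤ) * choose r x
    ≡⟨ cong (_+ (x + 1ℤ) * choose r x) (choose-absorption r x) ⟩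
  (+ r - x) * choose r x + (x + 1ℤ) * choose r x
    ≡⟨ regroup (+ r) x (choose r x) ⟩
  (+ suc r - x) * choose r x + x * choose r x
    ≡⟨ cong (λ y → (+ suc r - x) * choose r x + y) absorption-below ⟩
  (+ suc r - x) * choose r x + (+ r - (x - 1ℤ)) * choose r (x - 1ℤ)
    ≡⟨ cong (λ y → (+ suc r - x) * choose r x + y * choose r (x - 1ℤ)) (shift (+ r) x) ⟩
  (+ suc r - x) * choose r x + (+ suc r - x) * choose r (x - 1ℤ)
    ≡⟨ ℤ.*-distribˡ-+ (+ suc r - x) (choose r x) (choose r (x - 1ℤ)) ⟨
  (+ suc r - x) * (choose r x + choose r (x - 1ℤ))
    ≡⟨ cong ((+ suc r - x) *_) (choose-pascal r x) ⟨
  (+ suc r - x) * choose (suc r) x ∎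
  where
  open ≡-Reasoning
  regroup : ∀ r x c → (r - x) * c + (x + 1ℤ) * c ≡ (1ℤ + r - x) * c + x * c
  regroup = solve-∀
  shift : ∀ r x → r - (x - 1ℤ) ≡ 1ℤ + r - x
  shift = solve-∀
  absorption-below : x * choose r x ≡ (+ r - (x - 1ℤ)) * choose r (x - 1ℤ)
  absorption-below =
    trans (cong (λ y → y * choose r y) (sym (x-1+1≡x x))) (choose-absorption r (x - 1ℤ))

P′-vanishes : ∀ {r k} → r ℕ.< k → r P′ k ≡ 0
P′-vanishes {r} {suc k} r<1+k with ℕ.m≤n⇒m<n∨m≡n (ℕ.s≤s⁻¹ r<1+k)
... | inj₁ r<k  = trans (cong ((r ℕ.∸ k) ℕ.*_) (P′-vanishes r<k)) (ℕ.*-zeroʳ (r ℕ.∸ k))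
... | inj₂ refl = cong (ℕ._* (r P′ r)) (ℕ.n∸n≡0 r)

falling≡P′ : ∀ r k → falling (+ r) k ≡ + (r P′ k)
falling≡P′ r zero    = refl
falling≡P′ r (suc k) with k ℕ.≤? r
... | yes k≤r = begin
  falling (+ r) k * (+ r - + k) ≡⟨ cong₂ _*_ (falling≡P′ r k) (trans (ℤ.m-n≡m⊖n r k) (ℤ.⊖-≥ k≤r)) ⟩
  + (r P′ k) * + (r ℕ.∸ k)      ≡⟨ ℤ.pos-* (r P′ k) (r ℕ.∸ k) ⟨
  + ((r P′ k) ℕ.* (r ℕ.∸ k))    ≡⟨ cong +_ (ℕ.*-comm (r P′ k) (r ℕ.∸ k)) ⟩
  + ((r ℕ.∸ k) ℕ.* (r P′ k))    ∎
  where open ≡-Reasoning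
... | no k≰r = begin
  falling (+ r) k * (+ r - + k) ≡⟨ cong (_* (+ r - + k)) (trans (falling≡P′ r k) (cong +_ r[P′]k≡0)) ⟩
  0ℤ * (+ r - + k)              ≡⟨ ℤ.*-zeroˡ (+ r - + k) ⟩
  0ℤ                            ≡⟨ cong +_ (trans (cong ((r ℕ.∸ k) ℕ.*_) r[P′]k≡0) (ℕ.*-zeroʳ (r ℕ.∸ k))) ⟨
  + ((r ℕ.∸ k) ℕ.* (r P′ k))    ∎
  where
  open ≡-Reasoning
  r[P′]k≡0 : r P′ k ≡ 0
  r[P′]k≡0 = P′-vanishes (ℕ.≰⇒> k≰r)

C′≡C : ∀ r k → r C′ k ≡ r C k
C′≡C r k with k ℕ.≤? r
... | yes k≤r = trans (nC′k≡n!/k![n-k]! k≤r) (sym (nCk≡n!/k![n-k]! k≤r))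
... | no k≰r  = begin
  ((r P′ k) ℕ./ k ℕ.!) {{k !≢0}} ≡⟨ cong (λ p → (p ℕ./ k ℕ.!) {{k !≢0}}) (P′-vanishes (ℕ.≰⇒> k≰r)) ⟩
  (0 ℕ./ k ℕ.!) {{k !≢0}}       ≡⟨ 0/n≡0 (k ℕ.!) {{k !≢0}} ⟩
  0                              ≡⟨ k>n⇒nCk≡0 (ℕ.≰⇒> k≰r) ⟨
  r C k                          ∎
  where open ≡-Reasoning

binom≡choose : ∀ r j → binom (+ r) j ≡ choose r j
binom≡choose r (+ k)    =
  trans (cong (λ f → (f ℤ./ℕ (k ℕ.!)) {{k !≢0}}) (falling≡P′ r k)) (cong +_ (C′≡C r k))
binom≡choose r -[1+ k ] = refl

choose-pascal² : ∀ r j → choose (2 ℕ.+ r) j ≡ choose r j + + 2 * choose r (j - 1ℤ) + choose r (j - 1ℤ - 1ℤ)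
choose-pascal² r j = begin
  choose (2 ℕ.+ r) j
    ≡⟨ choose-pascal (suc r) j ⟩
  choose (suc r) j + choose (suc r) (j - 1ℤ)
    ≡⟨ cong₂ _+_ (choose-pascal r j) (choose-pascal r (j - 1ℤ)) ⟩
  choose r j + choose r (j - 1ℤ) + (choose r (j - 1ℤ) + choose r (j - 1ℤ - 1ℤ))
    ≡⟨ collect (choose r j) (choose r (j - 1ℤ)) (choose r (j - 1ℤ - 1ℤ)) ⟩
  choose r j + + 2 * choose r (j - 1ℤ) + choose r (j - 1ℤ - 1ℤ) ∎
  where
  open ≡-Reasoning
  collect : ∀ a b c → a + b + (b + c) ≡ a + + 2 * b + c
  collect = solve-∀

ballot : ℕ → ℤ → ℤ
ballot r j = choose r j - choose r (j - 1ℤ)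

ballot-pascal² : ∀ r j → ballot (2 ℕ.+ r) j ≡ ballot r j + + 2 * ballot r (j - 1ℤ) + ballot r (j - 1ℤ - 1ℤ)
ballot-pascal² r j = trans (cong₂ _-_ (choose-pascal² r j) (choose-pascal² r (j - 1ℤ)))
  (collect (choose r j) (choose r (j - 1ℤ)) (choose r (j - 1ℤ - 1ℤ)) (choose r (j - 1ℤ - 1ℤ - 1ℤ)))
  where
  collect : ∀ a b c d → a + + 2 * b + c - (b + + 2 * c + d) ≡ a - b + + 2 * (b - c) + (c - d)
  collect = solve-∀

weighted-pascal² : ∀ s k j →
  + suc k * choose (2 ℕ.+ s) j ≡ + k * choose s j + + 2 * (+ suc k * choose s (j - 1ℤ))
                                 + + suc (suc k) * choose s (j - 1ℤ - 1ℤ) + ballot (suc s) j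
weighted-pascal² s k j = begin
  + suc k * choose (2 ℕ.+ s) j
    ≡⟨ cong (+ suc k *_) (choose-pascal² s j) ⟩
  + suc k * (a + + 2 * b + c)
    ≡⟨ distribute (+ k) a b c ⟩
  + k * a + + 2 * (+ suc k * b) + + suc (suc k) * c + ((a + b) - (b + c))
    ≡⟨ cong₂ (λ x y → + k * a + + 2 * (+ suc k * b) + + suc (suc k) * c + (x - y))
             (choose-pascal s j) (choose-pascal s (j - 1ℤ)) ⟨
  + k * a + + 2 * (+ suc k * b) + + suc (suc k) * c + ballot (suc s) j ∎
  where
  open ≡-Reasoning
  a = choose s j
  b = choose s (j - 1ℤ)
  c = choose s (j - 1ℤ - 1ℤ)
  distribute : ∀ k a b c → (1ℤ + k) * (a + + 2 * b + c)
                         ≡ k * a + + 2 * ((1ℤ + k) * b) + (1ℤ + (1ℤ + k)) * c + ((a + b) - (b + c))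
  distribute = solve-∀

ballot-middle : ∀ m → ballot (suc (m ℕ.+ m)) (+ suc m) ≡ 0ℤ
ballot-middle m = trans (cong (λ c → + c - choose r (+ m)) symmetric) (ℤ.+-inverseʳ (choose r (+ m)))
  where
  r = suc (m ℕ.+ m)
  symmetric : r C suc m ≡ r C m
  symmetric = trans (nCk≡nC[n∸k] (ℕ.s≤s (ℕ.m≤n+m m m))) (cong (r C_) (ℕ.m+n∸n≡m m m))

closing-identity : ∀ m t → let r = suc (m ℕ.+ m); i = + suc m - + t; n = 3 ℕ.+ m in
  + suc t * choose (suc r) (i - 1ℤ - 1ℤ) + ballot (2 ℕ.+ r) i + ballot r (i - 1ℤ - 1ℤ)
    ≡ choose r i + choose r (i - 1ℤ) + (+ n - + 3) * choose r (i - 1ℤ - 1ℤ)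
      - (+ n + 1ℤ) * choose r (i - 1ℤ - 1ℤ - 1ℤ)
closing-identity m t = begin
  + suc t * choose (suc r) (i - 1ℤ - 1ℤ) + ballot (2 ℕ.+ r) i + ballot r (i - 1ℤ - 1ℤ)
    ≡⟨ cong₂ (λ x y → + suc t * x + y + ballot r (i - 1ℤ - 1ℤ))
             (choose-pascal r (i - 1ℤ - 1ℤ)) (ballot-pascal² r i) ⟩
  + suc t * (c₂ + c₃) + (c₀ - c₁ + + 2 * (c₁ - c₂) + (c₂ - c₃)) + (c₂ - c₃)
    ≡⟨ rearrange (+ m) (+ t) c₀ c₁ c₂ c₃ ⟩
  target + ((+ r - (i - 1ℤ - 1ℤ - 1ℤ)) * c₃ - (i - 1ℤ - 1ℤ) * c₂)
    ≡⟨ cong (λ x → target + ((+ r - (i - 1ℤ - 1ℤ - 1ℤ)) * c₃ - x)) absorption ⟩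
  target + ((+ r - (i - 1ℤ - 1ℤ - 1ℤ)) * c₃ - (+ r - (i - 1ℤ - 1ℤ - 1ℤ)) * c₃)
    ≡⟨ cong (_+_ target) (ℤ.+-inverseʳ ((+ r - (i - 1ℤ - 1ℤ - 1ℤ)) * c₃)) ⟩
  target + 0ℤ
    ≡⟨ ℤ.+-identityʳ target ⟩
  target ∎
  where
  open ≡-Reasoning
  r = suc (m ℕ.+ m)
  i = + suc m - + t
  n = 3 ℕ.+ m
  c₀ = choose r i
  c₁ = choose r (i - 1ℤ)
  c₂ = choose r (i - 1ℤ - 1ℤ)
  c₃ = choose r (i - 1ℤ - 1ℤ - 1ℤ)
  target = c₀ + c₁ + (+ n - + 3) * c₂ - (+ n + 1ℤ) * c₃
  absorption : (i - 1ℤ - 1ℤ) * c₂ ≡ (+ r - (i - 1ℤ - 1ℤ - 1ℤ)) * c₃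
  absorption = trans (cong (λ y → y * choose r y) (sym (x-1+1≡x (i - 1ℤ - 1ℤ))))
                     (choose-absorption r (i - 1ℤ - 1ℤ - 1ℤ))
  rearrange : ∀ m t c₀ c₁ c₂ c₃ → let i = 1ℤ + m - t; n = 1ℤ + (1ℤ + (1ℤ + m)) in
    (1ℤ + t) * (c₂ + c₃) + (c₀ - c₁ + + 2 * (c₁ - c₂) + (c₂ - c₃)) + (c₂ - c₃)
      ≡ c₀ + c₁ + (n - + 3) * c₂ - (n + 1ℤ) * c₃
        + ((1ℤ + (m + m) - (i - 1ℤ - 1ℤ - 1ℤ)) * c₃ - (i - 1ℤ - 1ℤ) * c₂)
  rearrange = solve-∀

binomialSum′ : ℤ → ℤ → ℤ → ℤ
binomialSum′ n a i =
  binom a (i - + 2) + binom a (i - + 3) + (n - + 3) * binom a (i - + 4) - (n + 1ℤ) * binom a (i - + 5)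

binomialSum : ℕ → ℕ → ℤ
binomialSum n t = binomialSum′ (+ n) (+ (2 ℕ.* n) - + 5) (+ n - + t)

binomialSum′-cong : ∀ n a i {c₀ c₁ c₂ c₃} →
  binom a (i - + 2) ≡ c₀ → binom a (i - + 3) ≡ c₁ → binom a (i - + 4) ≡ c₂ → binom a (i - + 5) ≡ c₃ →
  binomialSum′ n a i ≡ c₀ + c₁ + (n - + 3) * c₂ - (n + 1ℤ) * c₃
binomialSum′-cong n a i e₀ e₁ e₂ e₃ =
  cong₂ (λ x y → x - (n + 1ℤ) * y) (cong₂ (λ x y → x + (n - + 3) * y) (cong₂ _+_ e₀ e₁) e₂) e₃

binomialSum′-vanishes : ∀ n a t → binomialSum′ n a (+ 1 - + t) ≡ 0ℤ
binomialSum′-vanishes n a t =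
  trans (binomialSum′-cong n a (+ 1 - + t) (below 0) (below 1) (below 2) (below 3)) (zeros n)
  where
  negative : ∀ t k → 1ℤ - t - (+ 2 + k) ≡ - (1ℤ + (t + k))
  negative = solve-∀
  below : ∀ k → binom a (+ 1 - + t - + (2 ℕ.+ k)) ≡ 0ℤ
  below k = cong (binom a) (negative (+ t) (+ k))
  zeros : ∀ n → 0ℤ + 0ℤ + (n - + 3) * 0ℤ - (n + 1ℤ) * 0ℤ ≡ 0ℤ
  zeros = solve-∀

binomialSum-as-choose : ∀ m t → let r = suc (m ℕ.+ m); i = + suc m - + t; n = 3 ℕ.+ m in
  binomialSum n t ≡ choose r i + choose r (i - 1ℤ) + (+ n - + 3) * choose r (i - 1ℤ - 1ℤ)
                    - (+ n + 1ℤ) * choose r (i - 1ℤ - 1ℤ - 1ℤ)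
binomialSum-as-choose m t =
  binomialSum′-cong (+ n) _ (+ n - + t) (as-choose (shift₀ (+ m) (+ t))) (as-choose (shift₁ (+ m) (+ t)))
                                        (as-choose (shift₂ (+ m) (+ t))) (as-choose (shift₃ (+ m) (+ t)))
  where
  n = 3 ℕ.+ m
  top : ∀ m → + 2 * (1ℤ + (1ℤ + (1ℤ + m))) - + 5 ≡ 1ℤ + (m + m)
  top = solve-∀
  as-choose : ∀ {j k} → j ≡ k → binom (+ (2 ℕ.* n) - + 5) j ≡ choose (suc (m ℕ.+ m)) k
  as-choose j≡k = trans (cong₂ binom (trans (cong (_- + 5) (ℤ.pos-* 2 n)) (top (+ m))) j≡k) (binom≡choose _ _)
  shift₀ : ∀ m t → 1ℤ + (1ℤ + (1ℤ + m)) - t - + 2 ≡ 1ℤ + m - t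
  shift₀ = solve-∀
  shift₁ : ∀ m t → 1ℤ + (1ℤ + (1ℤ + m)) - t - + 3 ≡ 1ℤ + m - t - 1ℤ
  shift₁ = solve-∀
  shift₂ : ∀ m t → 1ℤ + (1ℤ + (1ℤ + m)) - t - + 4 ≡ 1ℤ + m - t - 1ℤ - 1ℤ
  shift₂ = solve-∀
  shift₃ : ∀ m t → 1ℤ + (1ℤ + (1ℤ + m)) - t - + 5 ≡ 1ℤ + m - t - 1ℤ - 1ℤ - 1ℤ
  shift₃ = solve-∀

coefficientAt : ℕ → ℕ → ℤ → ℤ[ε]
coefficientAt m k j = ballot (suc (m ℕ.+ m)) j , + k * choose (m ℕ.+ m) (j - 1ℤ - 1ℤ)

coefficient : ℕ → ℕ → ℤ[ε]
coefficient m k = coefficientAt m k (+ suc m - + k)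

coefficientAt-step : ∀ m k j →
  coefficientAt (suc m) (suc k) j ≡ coefficientAt m k j +ᵈ (1ᵈ +ᵈ 1ᵈ) *ᵈ coefficientAt m (suc k) (j - 1ℤ)
                                    +ᵈ (1ᵈ +ᵈ ε) *ᵈ coefficientAt m (suc (suc k)) (j - 1ℤ - 1ℤ)
coefficientAt-step m k j = begin
  ballot (suc (suc m ℕ.+ suc m)) j , + suc k * choose (suc m ℕ.+ suc m) (j - 1ℤ - 1ℤ)
    ≡⟨ cong (λ s → ballot (suc s) j , + suc k * choose s (j - 1ℤ - 1ℤ)) (ℕ.+-suc (suc m) m) ⟩
  ballot (2 ℕ.+ r) j , + suc k * choose (2 ℕ.+ s) (j - 1ℤ - 1ℤ)
    ≡⟨ cong₂ _,_ (ballot-pascal² r j) (weighted-pascal² s k (j - 1ℤ - 1ℤ)) ⟩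
  ballot r j + + 2 * ballot r (j - 1ℤ) + ballot r (j - 1ℤ - 1ℤ) ,
  + k * choose s (j - 1ℤ - 1ℤ) + + 2 * (+ suc k * choose s (j - 1ℤ - 1ℤ - 1ℤ))
    + + suc (suc k) * choose s (j - 1ℤ - 1ℤ - 1ℤ - 1ℤ) + ballot r (j - 1ℤ - 1ℤ)
    ≡⟨ recurrence-components (coefficientAt m k j) (coefficientAt m (suc k) (j - 1ℤ))
                             (coefficientAt m (suc (suc k)) (j - 1ℤ - 1ℤ)) ⟨
  coefficientAt m k j +ᵈ (1ᵈ +ᵈ 1ᵈ) *ᵈ coefficientAt m (suc k) (j - 1ℤ)
    +ᵈ (1ᵈ +ᵈ ε) *ᵈ coefficientAt m (suc (suc k)) (j - 1ℤ - 1ℤ) ∎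
  where
  open ≡-Reasoning
  s = m ℕ.+ m
  r = suc s

module GeneratingFunction (u : PowerSeries)
  (u-eq : u ≐ z· (𝟙 ⊕ (𝟙 ⊕ 𝟙) ⊛ u ⊕ (𝟙 ⊕ const ε) ⊛ (u ⊛ u))) where

  ^-step : ∀ k → u ^ suc k ≐ z· (u ^ k ⊕ (𝟙 ⊕ 𝟙) ⊛ u ^ suc k ⊕ (𝟙 ⊕ const ε) ⊛ u ^ suc (suc k))
  ^-step k = begin
    u ⊛ u ^ k
      ≈⟨ ⊛-cong u-eq (λ _ → refl) ⟩
    z· H ⊛ u ^ k
      ≈⟨ z·-⊛ H (u ^ k) ⟩
    z· (H ⊛ u ^ k)
      ≈⟨ z·-cong (solve 3 (λ u e P → (con 1 :+ con 2 :* u :+ (con 1 :+ e) :* (u :* u)) :* P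
                                     := P :+ con 2 :* (u :* P) :+ (con 1 :+ e) :* (u :* (u :* P)))
                          (λ _ → refl) u (const ε) (u ^ k)) ⟩
    z· (u ^ k ⊕ (𝟙 ⊕ 𝟙) ⊛ u ^ suc k ⊕ (𝟙 ⊕ const ε) ⊛ u ^ suc (suc k)) ∎
    where
    open ℤ[ε]⟦z⟧-Solver
    open import Relation.Binary.Reasoning.Setoid ℤ[ε]⟦z⟧.setoid
    H = 𝟙 ⊕ (𝟙 ⊕ 𝟙) ⊛ u ⊕ (𝟙 ⊕ const ε) ⊛ (u ⊛ u)

  ^suc-at-0 : ∀ k → (u ^ suc k) 0 ≡ 0ᵈ
  ^suc-at-0 k = trans (cong (_*ᵈ (u ^ k) 0) (u-eq 0)) (*ᵈ-zeroˡ ((u ^ k) 0))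

  ^-recurrence : ∀ k n → (u ^ suc k) (suc n)
                       ≡ (u ^ k) n +ᵈ (1ᵈ +ᵈ 1ᵈ) *ᵈ (u ^ suc k) n +ᵈ (1ᵈ +ᵈ ε) *ᵈ (u ^ suc (suc k)) n
  ^-recurrence k n = trans (^-step k (suc n))
    (cong₂ (λ x y → (u ^ k) n +ᵈ x +ᵈ y)
           (trans (⊛-cong (const-⊕ 1ᵈ 1ᵈ) (λ _ → refl) n) (const-⊛ (1ᵈ +ᵈ 1ᵈ) (u ^ suc k) n))
           (trans (⊛-cong (const-⊕ 1ᵈ ε) (λ _ → refl) n) (const-⊛ (1ᵈ +ᵈ ε) (u ^ suc (suc k)) n)))

  ^-coefficient : ∀ m k → (u ^ k) (suc m) ≡ coefficient m k
  ^-coefficient m       zero          =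
    sym (cong₂ _,_ (trans (cong (ballot (suc (m ℕ.+ m))) (ℤ.+-identityʳ (+ suc m))) (ballot-middle m)) refl)
  ^-coefficient zero    (suc zero)    =
    trans (^-recurrence 0 0) (cong₂ (λ x y → 1ᵈ +ᵈ (1ᵈ +ᵈ 1ᵈ) *ᵈ x +ᵈ (1ᵈ +ᵈ ε) *ᵈ y) (^suc-at-0 0) (^suc-at-0 1))
  ^-coefficient zero    (suc (suc k)) = begin
    (u ^ suc (suc k)) 1
      ≡⟨ ^-recurrence (suc k) 0 ⟩
    (u ^ suc k) 0 +ᵈ (1ᵈ +ᵈ 1ᵈ) *ᵈ (u ^ suc (suc k)) 0 +ᵈ (1ᵈ +ᵈ ε) *ᵈ (u ^ suc (suc (suc k))) 0
      ≡⟨ cong₂ _+ᵈ_ (cong₂ (λ x y → x +ᵈ (1ᵈ +ᵈ 1ᵈ) *ᵈ y) (^suc-at-0 k) (^suc-at-0 (suc k)))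
                    (cong ((1ᵈ +ᵈ ε) *ᵈ_) (^suc-at-0 (suc (suc k)))) ⟩
    0ᵈ
      ≡⟨ cong (0ℤ ,_) (ℤ.*-zeroʳ (+ suc (suc k))) ⟨
    coefficient 0 (suc (suc k)) ∎
    where open ≡-Reasoning
  ^-coefficient (suc m) (suc k)       = begin
    (u ^ suc k) (suc (suc m))
      ≡⟨ ^-recurrence k (suc m) ⟩
    (u ^ k) (suc m) +ᵈ (1ᵈ +ᵈ 1ᵈ) *ᵈ (u ^ suc k) (suc m) +ᵈ (1ᵈ +ᵈ ε) *ᵈ (u ^ suc (suc k)) (suc m)
      ≡⟨ cong₂ _+ᵈ_ (cong₂ (λ x y → x +ᵈ (1ᵈ +ᵈ 1ᵈ) *ᵈ y) (^-coefficient m k) (^-coefficient m (suc k)))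
                    (cong ((1ᵈ +ᵈ ε) *ᵈ_) (^-coefficient m (suc (suc k)))) ⟩
    coefficient m k +ᵈ (1ᵈ +ᵈ 1ᵈ) *ᵈ coefficient m (suc k) +ᵈ (1ᵈ +ᵈ ε) *ᵈ coefficient m (suc (suc k))
      ≡⟨ cong₂ (λ j′ j″ → coefficient m k +ᵈ (1ᵈ +ᵈ 1ᵈ) *ᵈ coefficientAt m (suc k) j′
                          +ᵈ (1ᵈ +ᵈ ε) *ᵈ coefficientAt m (suc (suc k)) j″)
               (a-[1+b]≡a-b-1 (+ suc m) (+ k)) (a-[2+b]≡a-b-1-1 (+ suc m) (+ k)) ⟩
    coefficientAt m k j +ᵈ (1ᵈ +ᵈ 1ᵈ) *ᵈ coefficientAt m (suc k) (j - 1ℤ)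
      +ᵈ (1ᵈ +ᵈ ε) *ᵈ coefficientAt m (suc (suc k)) (j - 1ℤ - 1ℤ)
      ≡⟨ coefficientAt-step m k j ⟨
    coefficientAt (suc m) (suc k) j
      ≡⟨ cong (coefficientAt (suc m) (suc k)) ([1+a]-[1+b]≡a-b (+ suc m) (+ k)) ⟨
    coefficient (suc m) (suc k) ∎
    where
    open ≡-Reasoning
    j = + suc m - + k

  ε²≐0 : const ε ⊛ const ε ≐ 𝟘
  ε²≐0 zero    = refl
  ε²≐0 (suc n) = const-⊛ ε (const ε) (suc n)

  module Quotient (t : ℕ) (q : PowerSeries)
    (q-eq : q ⊛ (𝟙 ⊕ u) ^ 2 ≐ (𝟙 ⊕ const ε) ⊛ u ^ suc (suc t)) where

    X : PowerSeries
    X = u ^ suc t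

    closed-form : q ≐ z· X ⊕ const ε ⊛ (z· X ⊕ z· (z· (u ⊛ X)))
    closed-form = begin
      q                                    ≈⟨ ⊛-cancelʳ W₀≡1 q G (≐-trans q-eq (≐-sym GW≐)) ⟩
      G                                    ≈⟨ G≐ ⟨
      z· X ⊕ e ⊛ (z· X ⊕ z· (z· (u ⊛ X)))   ∎
      where
      open ℤ[ε]⟦z⟧ using (setoid; +-cong; +-congˡ; *-congˡ; *-congʳ; +-identityʳ; zeroˡ; +-group)
        renaming (sym to ≐-sym; trans to ≐-trans)
      open import Relation.Binary.Reasoning.Setoid setoid
      open import Algebra.Properties.Group +-group using (∙-cancelʳ)
      open ℤ[ε]⟦z⟧-Solver
      e W K G P Y V : PowerSeries
      e = const ε
      W = (𝟙 ⊕ u) ^ 2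
      K = 𝟙 ⊕ e ⊕ e ⊛ (z ⊛ u)
      G = z ⊛ X ⊛ K
      P = e ⊛ (z ⊛ (u ⊛ u) ⊛ X)
      Y = z ⊛ (u ⊛ u) ⊛ X ⊛ (𝟙 ⊕ z ⊛ u)
      V = z ⊛ (𝟙 ⊕ (𝟙 ⊕ 𝟙) ⊛ u ⊕ (𝟙 ⊕ e) ⊛ (u ⊛ u))
      W₀≡1 : W 0 ≡ 1ᵈ
      W₀≡1 = cong (λ a → (1ᵈ +ᵈ a) *ᵈ ((1ᵈ +ᵈ a) *ᵈ 1ᵈ)) (u-eq 0)
      u≐V : u ≐ V
      u≐V = ≐-trans u-eq (z·-as-⊛ _)
      G≐ : z· X ⊕ e ⊛ (z· X ⊕ z· (z· (u ⊛ X))) ≐ G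
      G≐ = begin
        z· X ⊕ e ⊛ (z· X ⊕ z· (z· (u ⊛ X)))
          ≈⟨ +-cong (z·-as-⊛ X) (*-congˡ (+-cong (z·-as-⊛ X) (≐-trans (z·-as-⊛ _) (*-congˡ (z·-as-⊛ (u ⊛ X)))))) ⟩
        z ⊛ X ⊕ e ⊛ (z ⊛ X ⊕ z ⊛ (z ⊛ (u ⊛ X)))
          ≈⟨ solve 4 (λ z X e u → z :* X :+ e :* (z :* X :+ z :* (z :* (u :* X)))
                                  := z :* X :* (con 1 :+ e :+ e :* (z :* u)))
                     (λ _ → refl) z X e u ⟩
        G ∎
      -- V = z (1 + u)² + ε z u², so X K V = G W + P + ε² Y, while X K u = (1 + ε) u X + P.
      GW⊕P≐ : G ⊛ W ⊕ P ≐ (𝟙 ⊕ e) ⊛ (u ⊛ X) ⊕ P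
      GW⊕P≐ = begin
        G ⊛ W ⊕ P
          ≈⟨ +-identityʳ _ ⟨
        G ⊛ W ⊕ P ⊕ 𝟘
          ≈⟨ +-congˡ {G ⊛ W ⊕ P} (≐-trans (*-congʳ ε²≐0) (zeroˡ Y)) ⟨
        G ⊛ W ⊕ P ⊕ (e ⊛ e) ⊛ Y
          ≈⟨ solve 4 (λ z u e X →
               z :* X :* (con 1 :+ e :+ e :* (z :* u)) :* ((con 1 :+ u) :* ((con 1 :+ u) :* con 1))
               :+ e :* (z :* (u :* u) :* X)
               :+ (e :* e) :* (z :* (u :* u) :* X :* (con 1 :+ z :* u))
               := X :* (con 1 :+ e :+ e :* (z :* u)) :* (z :* (con 1 :+ con 2 :* u :+ (con 1 :+ e) :* (u :* u))))
               (λ _ → refl) z u e X ⟩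
        X ⊛ K ⊛ V
          ≈⟨ *-congˡ u≐V ⟨
        X ⊛ K ⊛ u
          ≈⟨ solve 4 (λ z u e X → X :* (con 1 :+ e :+ e :* (z :* u)) :* u
                                  := (con 1 :+ e) :* (u :* X) :+ e :* (z :* (u :* u) :* X))
                     (λ _ → refl) z u e X ⟩
        (𝟙 ⊕ e) ⊛ (u ⊛ X) ⊕ P ∎
      GW≐ : G ⊛ W ≐ (𝟙 ⊕ e) ⊛ (u ⊛ X)
      GW≐ = ∙-cancelʳ P _ _ GW⊕P≐

    derivative-at-suc : ∀ n → proj₂ (q (suc n)) ≡ proj₂ (X n) + (proj₁ (X n) + proj₁ ((z· (u ⊛ X)) n))
    derivative-at-suc n = begin
      proj₂ (q (suc n))
        ≡⟨ cong proj₂ (closed-form (suc n)) ⟩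
      proj₂ (X n +ᵈ (const ε ⊛ (z· X ⊕ z· (z· (u ⊛ X)))) (suc n))
        ≡⟨ cong (λ d → proj₂ (X n +ᵈ d)) (const-⊛ ε (z· X ⊕ z· (z· (u ⊛ X))) (suc n)) ⟩
      proj₂ (X n +ᵈ ε *ᵈ (X n +ᵈ (z· (u ⊛ X)) n))
        ≡⟨ ε-part (X n) (X n +ᵈ (z· (u ⊛ X)) n) ⟩
      proj₂ (X n) + (proj₁ (X n) + proj₁ ((z· (u ⊛ X)) n)) ∎
      where open ≡-Reasoning

    -- For n ≤ 2 the top 2n − 5 of the binomials is negative; these cases are checked directly.
    derivative : ∀ n → proj₂ (q (suc n)) ≡ binomialSum (suc n) t
    derivative zero =
      trans (derivative-at-suc 0)
            (trans (cong (λ a → proj₂ a + (proj₁ a + 0ℤ)) (^suc-at-0 t)) (sym (binomialSum′-vanishes (+ 1) _ t)))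
    derivative (suc zero) =
      trans (derivative-at-suc 1)
            (trans (cong₂ (λ a b → proj₂ a + (proj₁ a + proj₁ b)) (^-coefficient 0 (suc t)) (^suc-at-0 (suc t)))
                   (n≡2 t))
      where
      n≡2 : ∀ t → proj₂ (coefficient 0 (suc t)) + (proj₁ (coefficient 0 (suc t)) + 0ℤ) ≡ binomialSum 2 t
      n≡2 zero    = refl
      n≡2 (suc t) = trans (cong (_+ 0ℤ) (ℤ.*-zeroʳ (+ suc (suc t))))
                          (sym (trans (cong (binomialSum′ (+ 2) _) ([1+a]-[1+b]≡a-b (+ 1) (+ t)))
                                      (binomialSum′-vanishes (+ 2) _ t)))
    derivative (suc (suc m)) = begin
      proj₂ (q (3 ℕ.+ m))
        ≡⟨ derivative-at-suc (suc (suc m)) ⟩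
      proj₂ (X (suc (suc m))) + (proj₁ (X (suc (suc m))) + proj₁ ((u ^ suc (suc t)) (suc m)))
        ≡⟨ cong₂ (λ a b → proj₂ a + (proj₁ a + proj₁ b))
                 (^-coefficient (suc m) (suc t)) (^-coefficient m (suc (suc t))) ⟩
      proj₂ (coefficient (suc m) (suc t)) + (proj₁ (coefficient (suc m) (suc t)) + proj₁ (coefficient m (suc (suc t))))
        ≡⟨ cong₂ (λ s j → + suc t * choose s (j - 1ℤ - 1ℤ) + (ballot (suc s) j + proj₁ (coefficient m (suc (suc t)))))
                 (ℕ.+-suc (suc m) m) ([1+a]-[1+b]≡a-b (+ suc m) (+ t)) ⟩
      + suc t * choose (suc r) (i - 1ℤ - 1ℤ) + (ballot (2 ℕ.+ r) i + ballot r (+ suc m - + suc (suc t)))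
        ≡⟨ cong (λ j → + suc t * choose (suc r) (i - 1ℤ - 1ℤ) + (ballot (2 ℕ.+ r) i + ballot r j))
                (a-[2+b]≡a-b-1-1 (+ suc m) (+ t)) ⟩
      + suc t * choose (suc r) (i - 1ℤ - 1ℤ) + (ballot (2 ℕ.+ r) i + ballot r (i - 1ℤ - 1ℤ))
        ≡⟨ ℤ.+-assoc (+ suc t * choose (suc r) (i - 1ℤ - 1ℤ)) (ballot (2 ℕ.+ r) i) (ballot r (i - 1ℤ - 1ℤ)) ⟨
      + suc t * choose (suc r) (i - 1ℤ - 1ℤ) + ballot (2 ℕ.+ r) i + ballot r (i - 1ℤ - 1ℤ)
        ≡⟨ closing-identity m t ⟩
      choose r i + choose r (i - 1ℤ) + (+ (3 ℕ.+ m) - + 3) * choose r (i - 1ℤ - 1ℤ)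
        - (+ (3 ℕ.+ m) + 1ℤ) * choose r (i - 1ℤ - 1ℤ - 1ℤ)
        ≡⟨ binomialSum-as-choose m t ⟨
      binomialSum (3 ℕ.+ m) t ∎
      where
      open ≡-Reasoning
      r = suc (m ℕ.+ m)
      i = + suc m - + t

jetS-generating-equation : ∀ M →
  M ≈S (constS (constP 1ℤ) +S constS (constP (+ 2)) *S zS M +S constS αP *S zS (zS (M *S M))) →
  z· jetS M ≐ z· (𝟙 ⊕ (𝟙 ⊕ 𝟙) ⊛ z· jetS M ⊕ (𝟙 ⊕ const ε) ⊛ (z· jetS M ⊛ z· jetS M))
jetS-generating-equation M M-eq = z·-cong (begin
  m
    ≈⟨ jetS-cong M (c₁ +S c₂ *S zS M +S cα *S zS M²) M-eq ⟩
  jetS (c₁ +S c₂ *S zS M +S cα *S zS M²)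
    ≈⟨ ≐-trans (jetS-+S (c₁ +S c₂ *S zS M) (cα *S zS M²)) (+-congʳ {jetS (cα *S zS M²)} (jetS-+S c₁ (c₂ *S zS M))) ⟩
  jetS c₁ ⊕ jetS (c₂ *S zS M) ⊕ jetS (cα *S zS M²)
    ≈⟨ +-cong (+-congˡ {jetS c₁} (jetS-*S c₂ (zS M))) (jetS-*S cα (zS M²)) ⟩
  jetS c₁ ⊕ jetS c₂ ⊛ jetS (zS M) ⊕ jetS cα ⊛ jetS (zS M²)
    ≈⟨ +-cong (+-cong (jetS-constS (constP 1ℤ)) (*-cong two (jetS-zS M)))
              (*-cong jetS-α (≐-trans (jetS-zS M²) (z·-cong (≐-trans (jetS-zS (M *S M)) (z·-cong (jetS-*S M M)))))) ⟩
  𝟙 ⊕ (𝟙 ⊕ 𝟙) ⊛ z· m ⊕ (𝟙 ⊕ const ε) ⊛ z· (z· (m ⊛ m))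
    ≈⟨ +-congˡ {𝟙 ⊕ (𝟙 ⊕ 𝟙) ⊛ z· m} (*-congˡ {𝟙 ⊕ const ε} (z·-⊛-z· m m)) ⟨
  𝟙 ⊕ (𝟙 ⊕ 𝟙) ⊛ z· m ⊕ (𝟙 ⊕ const ε) ⊛ (z· m ⊛ z· m) ∎)
  where
  open ℤ[ε]⟦z⟧ using (setoid; +-cong; +-congˡ; +-congʳ; *-cong; *-congˡ) renaming (sym to ≐-sym; trans to ≐-trans)
  open import Relation.Binary.Reasoning.Setoid setoid
  m = jetS M
  c₁ c₂ cα M² : Series
  c₁ = constS (constP 1ℤ)
  c₂ = constS (constP (+ 2))
  cα = constS αP
  M² = zS (M *S M)
  two : jetS c₂ ≐ 𝟙 ⊕ 𝟙
  two = ≐-trans (jetS-constS (constP (+ 2))) (≐-sym (const-⊕ 1ᵈ 1ᵈ))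

jetS-quotient-equation : ∀ t M Q →
  Q *S ((constS (constP 1ℤ) +S zS M) ^S 2) ≈S constS αP *S (zS M ^S (t ℕ.+ 2)) →
  jetS Q ⊛ (𝟙 ⊕ z· jetS M) ^ 2 ≐ (𝟙 ⊕ const ε) ⊛ (z· jetS M) ^ suc (suc t)
jetS-quotient-equation t M Q Q-eq = begin
  jetS Q ⊛ (𝟙 ⊕ u) ^ 2                ≈⟨ *-congˡ {jetS Q} (^-cong base 2) ⟨
  jetS Q ⊛ jetS B ^ 2                  ≈⟨ *-congˡ {jetS Q} (jetS-^S B 2) ⟨
  jetS Q ⊛ jetS (B ^S 2)               ≈⟨ jetS-*S Q (B ^S 2) ⟨
  jetS (Q *S B ^S 2)                   ≈⟨ jetS-cong (Q *S B ^S 2) (cα *S (zS M ^S (t ℕ.+ 2))) Q-eq ⟩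
  jetS (cα *S zS M ^S (t ℕ.+ 2))       ≈⟨ jetS-*S cα (zS M ^S (t ℕ.+ 2)) ⟩
  jetS cα ⊛ jetS (zS M ^S (t ℕ.+ 2))   ≈⟨ *-cong jetS-α (≐-trans (jetS-^S (zS M) (t ℕ.+ 2)) (^-cong (jetS-zS M) (t ℕ.+ 2))) ⟩
  (𝟙 ⊕ const ε) ⊛ u ^ (t ℕ.+ 2)        ≡⟨ cong (λ k → (𝟙 ⊕ const ε) ⊛ u ^ k) (ℕ.+-comm t 2) ⟩
  (𝟙 ⊕ const ε) ⊛ u ^ suc (suc t)      ∎
  where
  open ℤ[ε]⟦z⟧ using (setoid; +-cong; *-cong; *-congˡ) renaming (trans to ≐-trans)
  open import Relation.Binary.Reasoning.Setoid setoid
  u = z· jetS M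
  B cα : Series
  B = constS (constP 1ℤ) +S zS M
  cα = constS αP
  base : jetS B ≐ 𝟙 ⊕ u
  base = ≐-trans (jetS-+S (constS (constP 1ℤ)) (zS M)) (+-cong (jetS-constS (constP 1ℤ)) (jetS-zS M))

lemma17 : (t n : ℕ) → 1 ≤ n →
          (M : Series) →
          M ≈S (constS (constP 1ℤ) +S constS (constP (+ 2)) *S zS M +S constS αP *S zS (zS (M *S M))) →
          (Q : Series) →
          Q *S ((constS (constP 1ℤ) +S zS M) ^S 2) ≈S constS αP *S (zS M ^S (t Data.Nat.+ 2)) →
          evalP (∂α (Q n)) 1ℤ
            ≡ binom (+ (2 Data.Nat.* n) - + 5) (+ n - + t - + 2)
              + binom (+ (2 Data.Nat.* n) - + 5) (+ n - + t - + 3)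
              + (+ n - + 3) * binom (+ (2 Data.Nat.* n) - + 5) (+ n - + t - + 4)
              - (+ n + 1ℤ) * binom (+ (2 Data.Nat.* n) - + 5) (+ n - + t - + 5)
lemma17 t (suc n) _ M M-eq Q Q-eq = Quotient.derivative t (jetS Q) (jetS-quotient-equation t M Q Q-eq) n
  where open GeneratingFunction (z· jetS M) (jetS-generating-equation M M-eq)
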